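{- Let $p$ be a prime and let $A$ and $B$ be adjacent vertices of $\Delta 334(SL_3(\mathbb{Z}))$ with $A\ne B$. Let $A'$ and $B'$ be the reductions of $A$ and $B$ modulo $p$ (elements of $SL_3(\mathbb{Z}/p\mathbb{Z})$). Then $A'$ and $B'$ are adjacent in $\Delta 334(SL_3(\mathbb{Z}/p\mathbb{Z}))$ and $A'\ne B'$.
   Context: For a group $G$ with identity $e$, the 334-triangle graph $\Delta 334(G)$ is the undirected graph (loops allowed) whose vertices are the elements $a\in G$ with $a^3=e$, with an edge between vertices $a$ and $b$ (possibly $a=b$) if and only if $(ab)^4=e$. $SL_3(R)$ denotes the group of $3\times 3$ matrices with entries in the ring $R$ and determinant $1$. -}

module Defs where

open import Level using (Level; _⊔_)
open import Algebra.Bundles.Raw using (RawRing)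
open import Data.Fin using (Fin; zero; suc)
open import Data.Nat using (ℕ)
open import Data.Product using (Σ; _×_; _,_; proj₁)
open import Relation.Nullary using (¬_)
open import Relation.Binary.PropositionalEquality using (_≡_; subst; sym)
import Data.Nat.Divisibility
import Data.Integer as ℤ
open import Data.Integer using (ℤ)
open import Data.Integer using (+_)
import Data.Integer.Divisibility as ℤDiv

module Matrices {c ℓ : Level} (R : RawRing c ℓ) where
  open RawRing R

  infixl 6 _-_
  _-_ : Carrier → Carrier → Carrier
  x - y = x + (- y)

  Mat3 : Set c
  Mat3 = Fin 3 → Fin 3 → Carrier

  _≈M_ : Mat3 → Mat3 → Set ℓ
  A ≈M B = ∀ i j → A i j ≈ B i j

  I3 : Mat3
  I3 zero                zero                = 1#
  I3 (suc zero)          (suc zero)          = 1#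
  I3 (suc (suc zero))    (suc (suc zero))    = 1#
  I3 _                   _                   = 0#

  _·_ : Mat3 → Mat3 → Mat3
  (A · B) i k = A i zero * B zero k + A i (suc zero) * B (suc zero) k
                + A i (suc (suc zero)) * B (suc (suc zero)) k

  infixl 7 _·_

  _^_ : Mat3 → ℕ → Mat3
  A ^ ℕ.zero  = I3
  A ^ ℕ.suc n = A · (A ^ n)

  det : Mat3 → Carrier
  det A = a * (e * i - f * h) - b * (d * i - f * g) + c' * (d * h - e * g)
    where
      a = A zero zero ; b = A zero (suc zero) ; c' = A zero (suc (suc zero))
      d = A (suc zero) zero ; e = A (suc zero) (suc zero) ; f = A (suc zero) (suc (suc zero))
      g = A (suc (suc zero)) zero ; h = A (suc (suc zero)) (suc zero) ; i = A (suc (suc zero)) (suc (suc zero))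

  SL3 : Set (c ⊔ ℓ)
  SL3 = Σ Mat3 (λ A → det A ≈ 1#)

  _≈SL_ : SL3 → SL3 → Set ℓ
  (A , _) ≈SL (B , _) = A ≈M B

  IsVertex334 : SL3 → Set ℓ
  IsVertex334 (A , _) = (A ^ 3) ≈M I3

  Edge334 : SL3 → SL3 → Set ℓ
  Edge334 (A , _) (B , _) = ((A · B) ^ 4) ≈M I3

  Adjacent334 : SL3 → SL3 → Set ℓ
  Adjacent334 a b = IsVertex334 a × IsVertex334 b × Edge334 a b

ℤRing : RawRing _ _
ℤRing = ℤ.+-*-rawRing

-- ℤ/pℤ, modelled as integers up to congruence modulo p
_≡_[mod_] : ℤ → ℤ → ℕ → Set
x ≡ y [mod p ] = (+ p) ℤDiv.∣ (x ℤ.- y)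

ℤmod : ℕ → RawRing _ _
ℤmod p = record
  { Carrier = ℤ
  ; _≈_ = λ x y → x ≡ y [mod p ]
  ; _+_ = ℤ._+_
  ; _*_ = ℤ._*_
  ; -_ = ℤ.-_
  ; 0# = + 0
  ; 1# = + 1
  }

module MZ = Matrices ℤRing
module MZp (p : ℕ) = Matrices (ℤmod p)

-- reduction modulo p: SL₃(ℤ) → SL₃(ℤ/pℤ), identity on integer entries
-- (det is computed by the same integer formula, so det ≡ 1 gives det ≡ 1 mod p)
reduce : (p : ℕ) → MZ.SL3 → MZp.SL3 p
reduce p (A , detA≡1) = A , subst (λ d → d ≡ + 1 [mod p ]) (sym detA≡1) p∣1-1
  where
    p∣1-1 : (+ 1) ≡ (+ 1) [mod p ]
    p∣1-1 = p Data.Nat.Divisibility.∣0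

{-# OPTIONS --safe #-}
module Submission where

open import Defs
open import Data.Nat using (ℕ)
open import Data.Nat.Primality using (Prime)
open import Data.Product using (_×_)
open import Relation.Nullary using (¬_)

open import Level using (Level)
open import Algebra.Bundles using (Monoid)
open import Algebra.Bundles.Raw using (RawRing)
open import Algebra.Definitions using (Congruent₂; Associative; LeftIdentity; RightIdentity)
open import Algebra.Structures using (IsMagma)
import Algebra.Properties.Monoid.Mult as MonoidPowers
open import Data.Empty using (⊥-elim)
open import Data.Fin using (zero; suc)
import Data.Nat.Base as ℕ
import Data.Nat.Properties as ℕ
import Data.Nat.Divisibility as ℕ
open import Data.Nat.Primality
  using (euclidsLemma; prime⇒irreducible; prime⇒nonTrivial; prime⇒nonZero; prime?)
open import Data.Integer using (ℤ; +_; _+_; _*_; -_; _-_; ∣_∣)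
import Data.Integer.Properties as ℤ
open import Data.Integer.Divisibility.Signed
  using (_∣_; divides; quotient; ∣ᵤ⇒∣; ∣⇒∣ᵤ; ∣m∣n⇒∣m+n; ∣n⇒∣m*n; ∣m⇒∣m*n; *-monoˡ-∣)
open import Data.Integer.Tactic.RingSolver using (solve-∀)
open import Algebra.Properties.AbelianGroup ℤ.+-0-abelianGroup
  using () renaming (∙-cancelˡ to +-cancelˡ)
open import Data.Product using (_,_)
open import Data.Sum using (inj₁; inj₂; [_,_]′)
open import Function using (id)
open import Relation.Binary.Structures using (IsEquivalence)
open import Relation.Binary.PropositionalEquality
  using (_≡_; _≢_; refl; sym; trans; cong; cong₂; subst; subst₂; module ≡-Reasoning)
open import Relation.Nullary.Decidable using (from-yes)
import Relation.Binary.Reasoning.Setoid as SetoidReasoning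

-- If A ≡ B (mod p), then I ≡ (AB)⁴ ≡ (A²)⁴ = A⁸ = A² (mod p), hence A = A⁴ ≡ I (mod p),
-- and likewise B ≡ I. But an integer matrix with A³ = I and A ≡ I (mod p) is I: writing
-- A = I + qY with p ∣ q, the cube gives 3Y + 3qY² + q²Y³ = 0, which forces p ∣ Y (using
-- 3 ∣ q when p = 3), so A ≡ I (mod pq); thus every power of p divides every entry of
-- A − I. So A = I = B, a contradiction. Adjacency survives reduction since reduction is
-- multiplicative.

pattern 0F = zero
pattern 1F = suc zero
pattern 2F = suc (suc zero)

module _ (p : ℕ) where

  ≡-mod⇒∣ : ∀ {x y} → x ≡ y [mod p ] → + p ∣ x - y
  ≡-mod⇒∣ {x} {y} = ∣ᵤ⇒∣ {+ p} {x - y}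

  ∣⇒≡-mod : ∀ x y → + p ∣ x - y → x ≡ y [mod p ]
  ∣⇒≡-mod x y = ∣⇒∣ᵤ

  ≡⇒≡-mod : ∀ {x y} → x ≡ y → x ≡ y [mod p ]
  ≡⇒≡-mod {x} refl = subst (λ d → p ℕ.∣ ∣ d ∣) (sym (ℤ.+-inverseʳ x)) (p ℕ.∣0)

  ≡-mod-isEquivalence : IsEquivalence (_≡_[mod p ])
  ≡-mod-isEquivalence = record
    { refl  = λ {x} → ≡⇒≡-mod {x} refl
    ; sym   = λ {x} {y} → subst (p ℕ.∣_) (ℤ.∣i-j∣≡∣j-i∣ x y)
    ; trans = λ {x} {y} {z} x≡y y≡z → ∣⇒≡-mod x z
        (subst (+ p ∣_) (split x y z) (∣m∣n⇒∣m+n (≡-mod⇒∣ {x} x≡y) (≡-mod⇒∣ {y} y≡z)))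
    }
    where
    split : ∀ x y z → (x + - y) + (y + - z) ≡ x + - z
    split = solve-∀

  +-cong-mod : Congruent₂ (_≡_[mod p ]) _+_
  +-cong-mod {a} {c} {b} {d} a≡c b≡d = ∣⇒≡-mod (a + b) (c + d)
    (subst (+ p ∣_) (split a b c d) (∣m∣n⇒∣m+n (≡-mod⇒∣ {a} a≡c) (≡-mod⇒∣ {b} b≡d)))
    where
    split : ∀ a b c d → (a + - c) + (b + - d) ≡ (a + b) + - (c + d)
    split = solve-∀

  *-cong-mod : Congruent₂ (_≡_[mod p ]) _*_
  *-cong-mod {a} {c} {b} {d} a≡c b≡d = ∣⇒≡-mod (a * b) (c * d)
    (subst (+ p ∣_) (split a b c d)
      (∣m∣n⇒∣m+n (∣n⇒∣m*n a (≡-mod⇒∣ {b} b≡d)) (∣m⇒∣m*n d (≡-mod⇒∣ {a} a≡c))))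
    where
    split : ∀ a b c d → a * (b + - d) + (a + - c) * d ≡ a * b + - (c * d)
    split = solve-∀

  -- x ≡ y [mod p ] does not determine x and y, so implicit arguments are passed on by hand.
  +-isMagma-mod : IsMagma (_≡_[mod p ]) _+_
  +-isMagma-mod = record
    { isEquivalence = ≡-mod-isEquivalence
    ; ∙-cong        = λ {a} {c} {b} {d} → +-cong-mod {a} {c} {b} {d}
    }

  *-isMagma-mod : IsMagma (_≡_[mod p ]) _*_
  *-isMagma-mod = record
    { isEquivalence = ≡-mod-isEquivalence
    ; ∙-cong        = λ {a} {c} {b} {d} → *-cong-mod {a} {c} {b} {d}
    }

prime∣3⇒≡3 : ∀ {p} → Prime p → p ℕ.∣ 3 → p ≡ 3
prime∣3⇒≡3 p-prime p∣3 with prime⇒irreducible (from-yes (prime? 3)) p∣3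
... | inj₁ p≡1 = ⊥-elim (ℕ.nonTrivial⇒≢1 {{prime⇒nonTrivial p-prime}} p≡1)
... | inj₂ p≡3 = p≡3

3∣q⇒3y+3qs+q²t≡0⇒3∣y : ∀ {q y s t} → + 3 ∣ q →
  + 3 * y + + 3 * q * s + q * q * t ≡ + 0 → + 3 ∣ y
3∣q⇒3y+3qs+q²t≡0⇒3∣y {y = y} {s} {t} (divides r refl) e = divides (- (r * s + r * r * t))
  (ℤ.*-cancelˡ-≡ (+ 3) _ _ (begin
    + 3 * y                                   ≡⟨ split y r s t ⟩
    (+ 3 * y + + 3 * (r * + 3) * s + (r * + 3) * (r * + 3) * t)
      + + 3 * (- (r * s + r * r * t) * + 3)   ≡⟨ cong (_+ + 3 * (- (r * s + r * r * t) * + 3)) e ⟩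
    + 0 + + 3 * (- (r * s + r * r * t) * + 3) ≡⟨ ℤ.+-identityˡ _ ⟩
    + 3 * (- (r * s + r * r * t) * + 3)       ∎))
  where
  open ≡-Reasoning
  split : ∀ y r s t → + 3 * y ≡ (+ 3 * y + + 3 * (r * + 3) * s + (r * + 3) * (r * + 3) * t)
                                 + + 3 * (- (r * s + r * r * t) * + 3)
  split = solve-∀

p∣q⇒3y+3qs+q²t≡0⇒p∣y : ∀ {p q y s t} → Prime p → + p ∣ q →
  + 3 * y + + 3 * q * s + q * q * t ≡ + 0 → + p ∣ y
p∣q⇒3y+3qs+q²t≡0⇒p∣y {p} {q} {y} {s} {t} p-prime p∣q e =
  [ p∣3⇒p∣y , ∣ᵤ⇒∣ {+ p} {y} ]′ (euclidsLemma 3 ∣ y ∣ p-prime p∣3∣y∣)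
  where
  open ≡-Reasoning
  split : ∀ y q s t → + 3 * y ≡ (+ 3 * y + + 3 * q * s + q * q * t) + q * - (+ 3 * s + q * t)
  split = solve-∀
  3y≡q*-[3s+qt] : + 3 * y ≡ q * - (+ 3 * s + q * t)
  3y≡q*-[3s+qt] = begin
    + 3 * y                                  ≡⟨ split y q s t ⟩
    (+ 3 * y + + 3 * q * s + q * q * t)
      + q * - (+ 3 * s + q * t)              ≡⟨ cong (_+ q * - (+ 3 * s + q * t)) e ⟩
    + 0 + q * - (+ 3 * s + q * t)            ≡⟨ ℤ.+-identityˡ _ ⟩
    q * - (+ 3 * s + q * t)                  ∎
  p∣3∣y∣ : p ℕ.∣ 3 ℕ.* ∣ y ∣
  p∣3∣y∣ = subst (p ℕ.∣_) (ℤ.abs-* (+ 3) y)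
    (∣⇒∣ᵤ (subst (+ p ∣_) (sym 3y≡q*-[3s+qt]) (∣m⇒∣m*n _ p∣q)))
  p∣3⇒p∣y : p ℕ.∣ 3 → + p ∣ y
  p∣3⇒p∣y p∣3 = subst (λ n → + n ∣ y) (sym p≡3)
    (3∣q⇒3y+3qs+q²t≡0⇒3∣y (subst (λ n → + n ∣ q) p≡3 p∣q) e)
    where p≡3 = prime∣3⇒≡3 p-prime p∣3

n<m^n : ∀ {m} → 1 ℕ.< m → ∀ n → n ℕ.< m ℕ.^ n
n<m^n 1<m ℕ.zero    = ℕ.z<s
n<m^n 1<m (ℕ.suc n) = ℕ.≤-<-trans (n<m^n 1<m n) (ℕ.^-monoʳ-< _ 1<m (ℕ.n<1+n n))

m^k∣n⇒n≡0 : ∀ {m n} → 1 ℕ.< m → (∀ k → m ℕ.^ k ℕ.∣ n) → n ≡ 0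
m^k∣n⇒n≡0 {n = ℕ.zero}  1<m m^k∣n = refl
m^k∣n⇒n≡0 {n = ℕ.suc n} 1<m m^k∣n = ⊥-elim (ℕ.>⇒∤ (n<m^n 1<m (ℕ.suc n)) (m^k∣n (ℕ.suc n)))

-- Elements of order dividing 3 in a monoid

module _ {a ℓ : Level} (M : Monoid a ℓ) where

  open Monoid M using (_≈_; _∙_; ε; ∙-cong; ∙-congˡ; ∙-congʳ; identityˡ; identityʳ; setoid)
  open MonoidPowers M using (×-congʳ; ×-homo-1; ×-homo-+; ×-assocˡ) renaming (_×_ to _×ₘ_)
  open SetoidReasoning setoid

  n×x≈ε⇒[n+m]×x≈m×x : ∀ {x} n m → n ×ₘ x ≈ ε → (n ℕ.+ m) ×ₘ x ≈ m ×ₘ x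
  n×x≈ε⇒[n+m]×x≈m×x {x} n m n×x≈ε = begin
    (n ℕ.+ m) ×ₘ x    ≈⟨ ×-homo-+ x n m ⟩
    n ×ₘ x ∙ m ×ₘ x   ≈⟨ ∙-congʳ n×x≈ε ⟩
    ε ∙ m ×ₘ x        ≈⟨ identityˡ (m ×ₘ x) ⟩
    m ×ₘ x            ∎

  3×x≈ε⇒4×[x∙y]≈ε⇒y≈x⇒x≈ε : ∀ {x y} → 3 ×ₘ x ≈ ε → 4 ×ₘ (x ∙ y) ≈ ε → y ≈ x → x ≈ ε
  3×x≈ε⇒4×[x∙y]≈ε⇒y≈x⇒x≈ε {x} {y} x³≈ε [xy]⁴≈ε y≈x = begin
    x                 ≈⟨ ×-homo-1 x ⟨
    1 ×ₘ x            ≈⟨ n×x≈ε⇒[n+m]×x≈m×x 3 1 x³≈ε ⟨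
    4 ×ₘ x            ≈⟨ ×-homo-+ x 2 2 ⟩
    2 ×ₘ x ∙ 2 ×ₘ x   ≈⟨ ∙-cong x²≈ε x²≈ε ⟩
    ε ∙ ε             ≈⟨ identityˡ ε ⟩
    ε                 ∎
    where
    x²≈ε : 2 ×ₘ x ≈ ε
    x²≈ε = begin
      2 ×ₘ x          ≈⟨ n×x≈ε⇒[n+m]×x≈m×x 3 2 x³≈ε ⟨
      5 ×ₘ x          ≈⟨ n×x≈ε⇒[n+m]×x≈m×x 3 5 x³≈ε ⟨
      8 ×ₘ x          ≈⟨ ×-assocˡ x 4 2 ⟨
      4 ×ₘ (2 ×ₘ x)   ≈⟨ ×-congʳ 4 (∙-congˡ (identityʳ x)) ⟩
      4 ×ₘ (x ∙ x)    ≈⟨ ×-congʳ 4 (∙-congˡ y≈x) ⟨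
      4 ×ₘ (x ∙ y)    ≈⟨ [xy]⁴≈ε ⟩
      ε               ∎

module MatrixCongruence {c ℓ : Level} (R : RawRing c ℓ)
  (+-isMagma : IsMagma (RawRing._≈_ R) (RawRing._+_ R))
  (*-isMagma : IsMagma (RawRing._≈_ R) (RawRing._*_ R)) where

  open Matrices R using (_≈M_; _·_)
  open IsMagma +-isMagma using () renaming (refl to ≈-refl; sym to ≈-sym; trans to ≈-trans; ∙-cong to +-cong)
  open IsMagma *-isMagma using () renaming (∙-cong to *-cong)

  ≈M-isEquivalence : IsEquivalence _≈M_
  ≈M-isEquivalence = record
    { refl  = λ i j → ≈-refl
    ; sym   = λ A≈B i j → ≈-sym (A≈B i j)
    ; trans = λ A≈B B≈C i j → ≈-trans (A≈B i j) (B≈C i j)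
    }

  ·-cong : Congruent₂ _≈M_ _·_
  ·-cong A≈B C≈D i k =
    +-cong (+-cong (*-cong (A≈B i 0F) (C≈D 0F k)) (*-cong (A≈B i 1F) (C≈D 1F k)))
           (*-cong (A≈B i 2F) (C≈D 2F k))

open MZ using (Mat3; _≈M_; _·_; _^_; I3)
open MatrixCongruence ℤRing ℤ.+-isMagma ℤ.*-isMagma

·-assoc : Associative _≈M_ _·_
·-assoc A B C i k = expand
  (A i 0F) (A i 1F) (A i 2F)
  (B 0F 0F) (B 0F 1F) (B 0F 2F) (B 1F 0F) (B 1F 1F) (B 1F 2F) (B 2F 0F) (B 2F 1F) (B 2F 2F)
  (C 0F k) (C 1F k) (C 2F k)
  where
  expand : ∀ a₀ a₁ a₂ b₀₀ b₀₁ b₀₂ b₁₀ b₁₁ b₁₂ b₂₀ b₂₁ b₂₂ c₀ c₁ c₂ →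
    (a₀ * b₀₀ + a₁ * b₁₀ + a₂ * b₂₀) * c₀ + (a₀ * b₀₁ + a₁ * b₁₁ + a₂ * b₂₁) * c₁
      + (a₀ * b₀₂ + a₁ * b₁₂ + a₂ * b₂₂) * c₂
    ≡ a₀ * (b₀₀ * c₀ + b₀₁ * c₁ + b₀₂ * c₂) + a₁ * (b₁₀ * c₀ + b₁₁ * c₁ + b₁₂ * c₂)
      + a₂ * (b₂₀ * c₀ + b₂₁ * c₁ + b₂₂ * c₂)
  expand = solve-∀

·-identityˡ : LeftIdentity _≈M_ I3 _·_
·-identityˡ A 0F k = first (A 0F k) (A 1F k) (A 2F k)
  where
  first : ∀ a b c → + 1 * a + + 0 * b + + 0 * c ≡ a
  first = solve-∀
·-identityˡ A 1F k = second (A 0F k) (A 1F k) (A 2F k)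
  where
  second : ∀ a b c → + 0 * a + + 1 * b + + 0 * c ≡ b
  second = solve-∀
·-identityˡ A 2F k = third (A 0F k) (A 1F k) (A 2F k)
  where
  third : ∀ a b c → + 0 * a + + 0 * b + + 1 * c ≡ c
  third = solve-∀

·-identityʳ : RightIdentity _≈M_ I3 _·_
·-identityʳ A i 0F = first (A i 0F) (A i 1F) (A i 2F)
  where
  first : ∀ a b c → a * + 1 + b * + 0 + c * + 0 ≡ a
  first = solve-∀
·-identityʳ A i 1F = second (A i 0F) (A i 1F) (A i 2F)
  where
  second : ∀ a b c → a * + 0 + b * + 1 + c * + 0 ≡ b
  second = solve-∀
·-identityʳ A i 2F = third (A i 0F) (A i 1F) (A i 2F)
  where
  third : ∀ a b c → a * + 0 + b * + 0 + c * + 1 ≡ c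
  third = solve-∀

·-monoid : Monoid _ _
·-monoid = record
  { Carrier  = Mat3
  ; _≈_      = _≈M_
  ; _∙_      = _·_
  ; ε        = I3
  ; isMonoid = record
    { isSemigroup = record
      { isMagma = record { isEquivalence = ≈M-isEquivalence ; ∙-cong = ·-cong }
      ; assoc   = ·-assoc
      }
    ; identity = ·-identityˡ , ·-identityʳ
    }
  }

open MonoidPowers ·-monoid using (×-congʳ)
open Monoid ·-monoid using (setoid; ∙-congˡ; ∙-congʳ) renaming (sym to ≈M-sym; trans to ≈M-trans)

infixl 6 _+ᴹ_
infixr 7 _∙_

_+ᴹ_ : Mat3 → Mat3 → Mat3
(A +ᴹ B) i j = A i j + B i j

_∙_ : ℤ → Mat3 → Mat3
(s ∙ A) i j = s * A i j

[A+sX]·[B+sZ] : ∀ s A B X Z →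
  ((A +ᴹ s ∙ X) · (B +ᴹ s ∙ Z)) ≈M (A · B +ᴹ s ∙ (X · B +ᴹ A · Z +ᴹ s ∙ (X · Z)))
[A+sX]·[B+sZ] s A B X Z i k = expand s
  (A i 0F) (A i 1F) (A i 2F) (B 0F k) (B 1F k) (B 2F k)
  (X i 0F) (X i 1F) (X i 2F) (Z 0F k) (Z 1F k) (Z 2F k)
  where
  expand : ∀ s a₀ a₁ a₂ b₀ b₁ b₂ x₀ x₁ x₂ z₀ z₁ z₂ →
    (a₀ + s * x₀) * (b₀ + s * z₀) + (a₁ + s * x₁) * (b₁ + s * z₁) + (a₂ + s * x₂) * (b₂ + s * z₂)
    ≡ (a₀ * b₀ + a₁ * b₁ + a₂ * b₂)
      + s * ((x₀ * b₀ + x₁ * b₁ + x₂ * b₂) + (a₀ * z₀ + a₁ * z₁ + a₂ * z₂)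
             + s * (x₀ * z₀ + x₁ * z₁ + x₂ * z₂))
  expand = solve-∀

[I+sX]·[I+sZ] : ∀ s X Z →
  ((I3 +ᴹ s ∙ X) · (I3 +ᴹ s ∙ Z)) ≈M (I3 +ᴹ s ∙ (X +ᴹ Z +ᴹ s ∙ (X · Z)))
[I+sX]·[I+sZ] s X Z i k = trans ([A+sX]·[B+sZ] s I3 I3 X Z i k)
  (cong₂ _+_ (·-identityˡ I3 i k)
    (cong (s *_) (cong (_+ s * (X · Z) i k) (cong₂ _+_ (·-identityʳ X i k) (·-identityˡ Z i k)))))

[I+sX]^3 : ∀ s X →
  ((I3 +ᴹ s ∙ X) ^ 3) ≈M (I3 +ᴹ s ∙ (+ 3 ∙ X +ᴹ (+ 3 * s) ∙ (X · X) +ᴹ (s * s) ∙ (X · (X · X))))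
[I+sX]^3 s X = begin
  A · (A · (A · I3))                   ≈⟨ ∙-congˡ {A} (∙-congˡ {A} (·-identityʳ A)) ⟩
  A · (A · A)                          ≈⟨ ∙-congˡ {A} ([I+sX]·[I+sZ] s X X) ⟩
  A · (I3 +ᴹ s ∙ W)                    ≈⟨ [I+sX]·[I+sZ] s X W ⟩
  I3 +ᴹ s ∙ (X +ᴹ W +ᴹ s ∙ (X · W))    ≈⟨ (λ i k → cong (λ r → I3 i k + s * r) (collect i k)) ⟩
  I3 +ᴹ s ∙ (+ 3 ∙ X +ᴹ (+ 3 * s) ∙ (X · X) +ᴹ (s * s) ∙ (X · (X · X))) ∎
  where
  open SetoidReasoning setoid
  A = I3 +ᴹ s ∙ X
  W = X +ᴹ X +ᴹ s ∙ (X · X)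
  collect : ∀ i k → (X +ᴹ W +ᴹ s ∙ (X · W)) i k
    ≡ (+ 3 ∙ X +ᴹ (+ 3 * s) ∙ (X · X) +ᴹ (s * s) ∙ (X · (X · X))) i k
  collect i k = expand s (X i k) (X i 0F) (X i 1F) (X i 2F) (X 0F k) (X 1F k) (X 2F k)
    ((X · X) 0F k) ((X · X) 1F k) ((X · X) 2F k)
    where
    expand : ∀ s x x₀ x₁ x₂ y₀ y₁ y₂ u₀ u₁ u₂ →
      x + (x + x + s * (x₀ * y₀ + x₁ * y₁ + x₂ * y₂))
        + s * (x₀ * (y₀ + y₀ + s * u₀) + x₁ * (y₁ + y₁ + s * u₁) + x₂ * (y₂ + y₂ + s * u₂))
      ≡ + 3 * x + + 3 * s * (x₀ * y₀ + x₁ * y₁ + x₂ * y₂) + s * s * (x₀ * u₀ + x₁ * u₁ + x₂ * u₂)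
    expand = solve-∀

module _ (p : ℕ) where

  open MZp p using () renaming (_≈M_ to _≋_; I3 to I3ₚ; _^_ to _^ₚ_)
  open MatrixCongruence (ℤmod p) (+-isMagma-mod p) (*-isMagma-mod p)
    renaming (≈M-isEquivalence to ≋-isEquivalence; ·-cong to ·-cong-mod)

  I3ₚ≈I3 : I3ₚ ≈M I3
  I3ₚ≈I3 0F 0F = refl
  I3ₚ≈I3 0F 1F = refl
  I3ₚ≈I3 0F 2F = refl
  I3ₚ≈I3 1F 0F = refl
  I3ₚ≈I3 1F 1F = refl
  I3ₚ≈I3 1F 2F = refl
  I3ₚ≈I3 2F 0F = refl
  I3ₚ≈I3 2F 1F = refl
  I3ₚ≈I3 2F 2F = refl

  ≈⇒≋ : ∀ {A B} → A ≈M B → A ≋ B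
  ≈⇒≋ A≈B i j = ≡⇒≡-mod p (A≈B i j)

  ·-monoid-mod : Monoid _ _
  ·-monoid-mod = record
    { Carrier  = Mat3
    ; _≈_      = _≋_
    ; _∙_      = _·_
    ; ε        = I3ₚ
    ; isMonoid = record
      { isSemigroup = record
        { isMagma = record
          { isEquivalence = ≋-isEquivalence
          ; ∙-cong        = λ {A} {B} {C} {D} → ·-cong-mod {A} {B} {C} {D}
          }
        ; assoc   = λ A B C → ≈⇒≋ (·-assoc A B C)
        }
      ; identity = (λ A → ≈⇒≋ (≈M-trans (∙-congʳ {A} I3ₚ≈I3) (·-identityˡ A)))
                 , (λ A → ≈⇒≋ (≈M-trans (∙-congˡ {A} I3ₚ≈I3) (·-identityʳ A)))
      }
    }

  ^≈I⇒^ₚ≋I : ∀ A n → (A ^ n) ≈M I3 → (A ^ₚ n) ≋ I3ₚ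
  ^≈I⇒^ₚ≋I A n Aⁿ≈I = ≈⇒≋ (≈M-trans (^ₚ≈^ n) (≈M-trans Aⁿ≈I (≈M-sym I3ₚ≈I3)))
    where
    ^ₚ≈^ : ∀ n → (A ^ₚ n) ≈M (A ^ n)
    ^ₚ≈^ ℕ.zero    = I3ₚ≈I3
    ^ₚ≈^ (ℕ.suc n) = ∙-congˡ {A} (^ₚ≈^ n)

  ≋I⇒p∣A-I : ∀ A → A ≋ I3ₚ → ∀ i k → + p ∣ A i k - I3 i k
  ≋I⇒p∣A-I A A≋I i k =
    ≡-mod⇒∣ p {A i k} (subst (λ e → A i k ≡ e [mod p ]) (I3ₚ≈I3 i k) (A≋I i k))

-- The kernel of reduction modulo a prime contains no element of order 3

module _ {p : ℕ} (p-prime : Prime p) where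

  open MZp p using () renaming (_≈M_ to _≋_; I3 to I3ₚ)

  [I+qY]^3≈I⇒p∣Y : ∀ {q} Y → q ≢ + 0 → + p ∣ q → ((I3 +ᴹ q ∙ Y) ^ 3) ≈M I3 →
    ∀ i k → + p ∣ Y i k
  [I+qY]^3≈I⇒p∣Y {q} Y q≢0 p∣q cube≈I i k =
    p∣q⇒3y+3qs+q²t≡0⇒p∣y {y = Y i k} {(Y · Y) i k} {(Y · (Y · Y)) i k} p-prime p∣q r≡0
    where
    r = (+ 3 ∙ Y +ᴹ (+ 3 * q) ∙ (Y · Y) +ᴹ (q * q) ∙ (Y · (Y · Y))) i k
    q*r≡0 : q * r ≡ + 0
    q*r≡0 = +-cancelˡ (I3 i k) (q * r) (+ 0)
      (trans (sym ([I+sX]^3 q Y i k)) (trans (cube≈I i k) (sym (ℤ.+-identityʳ (I3 i k)))))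
    r≡0 : r ≡ + 0
    r≡0 = [ (λ q≡0 → ⊥-elim (q≢0 q≡0)) , id ]′ (ℤ.i*j≡0⇒i≡0∨j≡0 q q*r≡0)

  q∣A-I⇒pq∣A-I : ∀ A {q} → (A ^ 3) ≈M I3 → q ≢ 0 → p ℕ.∣ q →
    (∀ i k → + q ∣ A i k - I3 i k) → ∀ i k → + (p ℕ.* q) ∣ A i k - I3 i k
  q∣A-I⇒pq∣A-I A {q} A³≈I q≢0 p∣q q∣A-I i k =
    subst₂ _∣_ (sym (ℤ.pos-* p q)) (sym (_∣_.equality (q∣A-I i k))) (*-monoˡ-∣ (+ q) (p∣Y i k))
    where
    Y : Mat3
    Y i k = quotient (q∣A-I i k)
    A≈I+qY : A ≈M (I3 +ᴹ + q ∙ Y)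
    A≈I+qY i k = trans (split (A i k) (I3 i k))
      (cong (λ r → I3 i k + r) (trans (_∣_.equality (q∣A-I i k)) (ℤ.*-comm (Y i k) (+ q))))
      where
      split : ∀ x y → x ≡ y + (x + - y)
      split = solve-∀
    p∣Y = [I+qY]^3≈I⇒p∣Y Y (λ q≡0 → q≢0 (cong ∣_∣ q≡0)) (∣ᵤ⇒∣ {+ p} {+ q} p∣q)
      (≈M-trans (×-congʳ 3 (≈M-sym A≈I+qY)) A³≈I)

  p∣A-I⇒p^[1+n]∣A-I : ∀ A → (A ^ 3) ≈M I3 → (∀ i k → + p ∣ A i k - I3 i k) →
    ∀ n i k → + (p ℕ.^ ℕ.suc n) ∣ A i k - I3 i k
  p∣A-I⇒p^[1+n]∣A-I A A³≈I p∣A-I ℕ.zero i k =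
    subst (λ m → + m ∣ A i k - I3 i k) (sym (ℕ.*-identityʳ p)) (p∣A-I i k)
  p∣A-I⇒p^[1+n]∣A-I A A³≈I p∣A-I (ℕ.suc n) =
    q∣A-I⇒pq∣A-I A A³≈I p^[1+n]≢0 (ℕ.m∣m*n (p ℕ.^ n)) (p∣A-I⇒p^[1+n]∣A-I A A³≈I p∣A-I n)
    where
    p^[1+n]≢0 = ℕ.≢-nonZero⁻¹ _ {{ℕ.m^n≢0 p (ℕ.suc n) {{prime⇒nonZero p-prime}}}}

  A^3≈I∧A≋I⇒A≈I : ∀ A → (A ^ 3) ≈M I3 → A ≋ I3ₚ → A ≈M I3
  A^3≈I∧A≋I⇒A≈I A A³≈I A≋I i k = ℤ.i-j≡0⇒i≡j _ _ (ℤ.∣i∣≡0⇒i≡0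
    (m^k∣n⇒n≡0 (ℕ.nonTrivial⇒n>1 p {{prime⇒nonTrivial p-prime}}) p^n∣A-I))
    where
    p^n∣A-I : ∀ n → p ℕ.^ n ℕ.∣ ∣ A i k - I3 i k ∣
    p^n∣A-I ℕ.zero    = ℕ.1∣ _
    p^n∣A-I (ℕ.suc n) = ∣⇒∣ᵤ (p∣A-I⇒p^[1+n]∣A-I A A³≈I (≋I⇒p∣A-I p A A≋I) n i k)

lemma6 : (p : ℕ) → Prime p → (A B : MZ.SL3) →
    MZ.Adjacent334 A B → ¬ (A MZ.≈SL B) →
    MZp.Adjacent334 p (reduce p A) (reduce p B) × ¬ (MZp._≈SL_ p (reduce p A) (reduce p B))
lemma6 p p-prime (A , _) (B , _) (A³≈I , B³≈I , [AB]⁴≈I) A≉B =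
  (A³≋I , ^≈I⇒^ₚ≋I p B 3 B³≈I , [AB]⁴≋I) , A≭B
  where
  open Monoid (·-monoid-mod p) using () renaming (sym to ≋-sym; trans to ≋-trans)
  A³≋I = ^≈I⇒^ₚ≋I p A 3 A³≈I
  [AB]⁴≋I = ^≈I⇒^ₚ≋I p (A · B) 4 [AB]⁴≈I
  A≭B : ¬ MZp._≈M_ p A B
  A≭B A≋B = A≉B (≈M-trans A≈I (≈M-sym B≈I))
    where
    B≋A = ≋-sym {A} {B} A≋B
    A≋I = 3×x≈ε⇒4×[x∙y]≈ε⇒y≈x⇒x≈ε (·-monoid-mod p) {A} {B} A³≋I [AB]⁴≋I B≋A
    A≈I = A^3≈I∧A≋I⇒A≈I p-prime A A³≈I A≋I
    B≈I = A^3≈I∧A≋I⇒A≈I p-prime B B³≈I (≋-trans {B} {A} B≋A A≋I)
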